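{- Let $r\ge 2$ and $a_1,\ldots,a_r$ be integers with $a_i\ge 2$ for all $i$, and let $G$ be the cograph with balanced cotree $T_G(a_1,\ldots,a_{r-1},0\,|\,0,\ldots,0,a_r)$, of order $n=a_1a_2\cdots a_r$. For $1\le i\le r-1$ define $$x_r^{i}=\begin{cases}\displaystyle\sum_{k=1}^{r-i}\gamma_{r,i+k}(-1)^{k}+\varepsilon_r & \text{if } i \text{ is even},\\[2mm] \displaystyle\sum_{k=1}^{r-i}\gamma_{r,i+k}(-1)^{k+1}+\varepsilon_r & \text{if } i \text{ is odd},\end{cases}$$ where $\varepsilon_r=1$ if $r$ is odd and $\varepsilon_r=0$ if $r$ is even. Then, counted with multiplicity, the eigenvalues of the adjacency matrix of $G$ are: $-x_r^{i}$ with multiplicity $a_1\cdots a_{i-1}(a_i-1)$ for each $1\le i\le r-1$; the value $-1$ (if $r$ is odd) or $0$ (if $r$ is even) with multiplicity $a_1\cdots a_{r-1}(a_r-1)$; and one remaining eigenvalue $$\lambda=\begin{cases}\displaystyle\sum_{i=1}^{r-1}a_1\cdots a_{i-1}(a_i-1)\,x_r^{i} & \text{if } r \text{ is even},\\[2mm] \displaystyle\sum_{i=1}^{r-1}a_1\cdots a_{i-1}(a_i-1)\,x_r^{i}+a_1\cdots a_{r-1}(a_r-1) & \text{if } r \text{ is odd}.\end{cases}$$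
   Context: A cograph is a graph built from single vertices by disjoint unions and joins; it is represented by a rooted cotree whose leaves are the vertices of the graph and whose internal nodes are labelled $\otimes$ (join) or $\cup$ (union); two vertices are adjacent iff their lowest common ancestor in the cotree is a $\otimes$ node. The balanced cotree $T_G(a_1,\ldots,a_{r-1},0\,|\,0,\ldots,0,a_r)$ of depth $r$ is the rooted tree in which the root (level $0$) is a $\otimes$ node, every internal node at level $\ell$ ($0\le \ell\le r-1$) is labelled $\otimes$ if $\ell$ is even and $\cup$ if $\ell$ is odd, each internal node at level $\ell$ with $0\le\ell\le r-2$ has exactly $a_{\ell+1}$ children, all internal, and each node at level $r-1$ has exactly $a_r$ children, which are leaves. For $l\le n$, $\gamma_{n,l}=a_na_{n-1}\cdots a_l$. -}

module Defs where

open import Data.Nat as ℕ using (ℕ; zero; suc; _∸_)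
open import Data.Integer as ℤ using (ℤ; +_; -_; _-_)
open import Data.Fin using (Fin; zero; suc; splitAt; punchIn)
open import Data.Sum using (inj₁; inj₂)
open import Data.Bool using (Bool; true; false; if_then_else_; not)
open import Data.List using (List; []; _∷_; replicate; applyUpTo; concat; map; _++_; [_])

isEven : ℕ → Bool
isEven zero = true
isEven (suc n) = not (isEven n)

negOnePow : ℕ → ℤ
negOnePow zero = + 1
negOnePow (suc k) = - negOnePow k

sumFin : ∀ {n} → (Fin n → ℤ) → ℤ
sumFin {zero} f = + 0
sumFin {suc n} f = f zero ℤ.+ sumFin (λ i → f (suc i))

prodFrom : (ℕ → ℕ) → ℕ → ℕ → ℕ
prodFrom a l zero = 1
prodFrom a l (suc m) = a l ℕ.* prodFrom a (suc l) m

sumFrom : (ℕ → ℤ) → ℕ → ℕ → ℤ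
sumFrom f l zero = + 0
sumFrom f l (suc m) = f l ℤ.+ sumFrom f (suc l) m

-- γ_{n,l} = a_n a_{n-1} ... a_l   (for l ≤ n)
γ : (ℕ → ℕ) → ℕ → ℕ → ℤ
γ a n l = + prodFrom a l (suc n ∸ l)

Matrix : ℕ → Set
Matrix n = Fin n → Fin n → ℤ

det : ∀ {n} → Matrix n → ℤ
det {zero} M = + 1
det {suc n} M =
  sumFin (λ j → negOnePow (Data.Fin.toℕ j) ℤ.* (M zero j ℤ.* det (λ i k → M (suc i) (punchIn j k))))

δ : ∀ {n} → Fin n → Fin n → ℤ
δ zero zero = + 1
δ zero (suc j) = + 0
δ (suc i) zero = + 0
δ (suc i) (suc j) = δ i j

charPolyAt : ∀ {n} → Matrix n → ℤ → ℤ
charPolyAt M x = det (λ i j → x ℤ.* δ i j - M i j)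

productℤ : List ℤ → ℤ
productℤ [] = + 1
productℤ (z ∷ zs) = z ℤ.* productℤ zs

-- The list λs is the list of eigenvalues of M counted with (algebraic)
-- multiplicity: det (x I - M) = ∏_{λ ∈ λs} (x - λ) as polynomials, which
-- (both sides being integer polynomials) is equivalent to equality at every
-- integer x.
IsSpectrum : ∀ {n} → Matrix n → List ℤ → Set
IsSpectrum M λs = ∀ (x : ℤ) → charPolyAt M x Relation.Binary.PropositionalEquality.≡ productℤ (map (λ l → x - l) λs)
  where import Relation.Binary.PropositionalEquality

data Label : Set where
  join  : Label
  union : Label

data Cotree : Set where
  leaf : Cotree
  node : Label → List Cotree → Cotree

mutual
  size : Cotree → ℕ
  size leaf = 1
  size (node l ts) = sizes ts

  sizes : List Cotree → ℕ
  sizes [] = 0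
  sizes (t ∷ ts) = size t ℕ.+ sizes ts

cross : Label → ℤ
cross join = + 1
cross union = + 0

-- Adjacency matrix of the cograph of a cotree: leaves are numbered left to
-- right; two distinct leaves are adjacent iff their lowest common ancestor is
-- a ⊗ node.
mutual
  adj : (t : Cotree) → Matrix (size t)
  adj leaf i j = + 0
  adj (node l ts) i j = adjs l ts i j

  adjs : Label → (ts : List Cotree) → Matrix (sizes ts)
  adjs l (t ∷ ts) i j with splitAt (size t) i | splitAt (size t) j
  ... | inj₁ p | inj₁ q = adj t p q
  ... | inj₂ p | inj₂ q = adjs l ts p q
  ... | inj₁ p | inj₂ q = cross l
  ... | inj₂ p | inj₁ q = cross l

levelLabel : ℕ → Label
levelLabel ℓ = if isEven ℓ then join else union

-- balancedFrom ℓ (a_{ℓ+1} ∷ ... ∷ a_r) : subtree rooted at an internal node of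
-- level ℓ; it has a_{ℓ+1} children, each a subtree rooted at level ℓ+1.
balancedFrom : ℕ → List ℕ → Cotree
balancedFrom ℓ [] = leaf
balancedFrom ℓ (a ∷ as) = node (levelLabel ℓ) (replicate a (balancedFrom (suc ℓ) as))

-- T_G(a_1,...,a_{r-1},0 | 0,...,0,a_r), with a given as a function ℕ → ℕ
-- (only a 1, ..., a r are used)
balancedCotree : (r : ℕ) → (ℕ → ℕ) → Cotree
balancedCotree r a = balancedFrom 0 (applyUpTo (λ k → a (suc k)) r)

ε : ℕ → ℤ
ε r = if isEven r then + 0 else + 1

xr : (ℕ → ℕ) → ℕ → ℕ → ℤ
xr a r i = if isEven i
  then sumFrom (λ k → γ a r (i ℕ.+ k) ℤ.* negOnePow k) 1 (r ∸ i) ℤ.+ ε r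
  else sumFrom (λ k → γ a r (i ℕ.+ k) ℤ.* negOnePow (suc k)) 1 (r ∸ i) ℤ.+ ε r

mult : (ℕ → ℕ) → ℕ → ℕ
mult a i = prodFrom a 1 (i ∸ 1) ℕ.* (a i ∸ 1)

lastEig : (ℕ → ℕ) → ℕ → ℤ
lastEig a r = if isEven r
  then sumFrom (λ i → + mult a i ℤ.* xr a r i) 1 (r ∸ 1)
  else sumFrom (λ i → + mult a i ℤ.* xr a r i) 1 (r ∸ 1) ℤ.+ + mult a r

spectrumList : (ℕ → ℕ) → ℕ → List ℤ
spectrumList a r =
  concat (applyUpTo (λ k → replicate (mult a (suc k)) (- xr a r (suc k))) (r ∸ 1))
  ++ replicate (mult a r) (if isEven r then + 0 else - (+ 1))
  ++ [ lastEig a r ]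

-- Let N = xI − A be the characteristic matrix of a cograph. If every column of N sums to α
-- (the cograph is regular of degree x − α), adding all rows to the first and subtracting the
-- first column from the others gives det N = α · det (reduce N). A cotree node with n ≥ 1
-- copies of such a child t has a block matrix N with off-diagonal entries −c (c = 1 at ⊗,
-- 0 at ∪); block-triangular determinants show that it is again regular, with reduced
-- determinant ρ · ((α + c·|t|) · ρ)^(n−1). Descending the levels of the balanced cotree gives
-- det (xI − A) = (x − λ) · ∏_{i=1}^{r} (x + x_r^i)^{mult_i}: the factor contributed by level i
-- is x + x_r^i by the telescoping x_r^i = (−1)^(i+1) γ_{r,i+1} + x_r^(i+1), and summing the
-- levels weighted by their multiplicities gives the degree λ.
module Submission where

open import Defs
open import Data.Nat as ℕ using (ℕ; zero; suc; z≤n; s≤s; _≤_; _<_; _∸_)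
import Data.Nat.Properties as ℕP
open import Data.Integer using (ℤ; +_; -[1+_]; -_; _-_; _+_; _*_; _^_)
import Data.Integer.Properties as ℤP
open import Data.Integer.Tactic.RingSolver using (solve-∀)
open import Data.Fin using (Fin; zero; suc; toℕ; punchIn; splitAt; _↑ˡ_; _↑ʳ_)
open import Data.Fin.Properties using (toℕ<n; toℕ-↑ˡ; toℕ-↑ʳ; join-splitAt; splitAt-↑ˡ; splitAt-↑ʳ)
open import Data.Sum using (inj₁; inj₂)
open import Data.Empty using (⊥-elim)
open import Data.Bool using (true; false; not; if_then_else_)
open import Data.List using (List; []; _∷_; [_]; _++_; map; concat; replicate; applyUpTo)
open import Data.List.Properties using (map-++; map-replicate; map-applyUpTo; concat-map; map-∘)
open import Function using (_∘_; id)
open import Data.Product using (_×_; _,_)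
import Data.Vec.Functional as Vector
open import Relation.Binary.Core using (_Preserves_⟶_)
open import Relation.Binary.PropositionalEquality hiding ([_])

sumFin-cong : ∀ {n} {f g : Fin n → ℤ} → (∀ i → f i ≡ g i) → sumFin f ≡ sumFin g
sumFin-cong {zero}  f≗g = refl
sumFin-cong {suc n} f≗g = cong₂ _+_ (f≗g zero) (sumFin-cong (f≗g ∘ suc))

sumFin-+ : ∀ {n} (f g : Fin n → ℤ) → sumFin (λ i → f i + g i) ≡ sumFin f + sumFin g
sumFin-+ {zero}  f g = refl
sumFin-+ {suc n} f g =
  trans (cong (λ s → f zero + g zero + s) (sumFin-+ (f ∘ suc) (g ∘ suc)))
        (swap-middle (f zero) (g zero) (sumFin (f ∘ suc)) (sumFin (g ∘ suc)))
  where
  swap-middle : ∀ a b c d → a + b + (c + d) ≡ a + c + (b + d)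
  swap-middle = solve-∀

sumFin-*ˡ : ∀ {n} c (f : Fin n → ℤ) → sumFin (λ i → c * f i) ≡ c * sumFin f
sumFin-*ˡ {zero}  c f = sym (ℤP.*-zeroʳ c)
sumFin-*ˡ {suc n} c f =
  trans (cong (λ s → c * f zero + s) (sumFin-*ˡ c (f ∘ suc))) (sym (ℤP.*-distribˡ-+ c (f zero) _))

sumFin-linear : ∀ {n} (f g : Fin n → ℤ) d → sumFin (λ i → f i + d * g i) ≡ sumFin f + d * sumFin g
sumFin-linear f g d = trans (sumFin-+ f (λ i → d * g i)) (cong (λ s → sumFin f + s) (sumFin-*ˡ d g))

sumFin-*ʳ : ∀ {n} c (f : Fin n → ℤ) → sumFin (λ i → f i * c) ≡ sumFin f * c
sumFin-*ʳ c f =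
  trans (sumFin-cong (λ i → ℤP.*-comm (f i) c)) (trans (sumFin-*ˡ c f) (ℤP.*-comm c _))

sumFin-const : ∀ n c → sumFin {n} (λ _ → c) ≡ c * + n
sumFin-const zero    c = sym (ℤP.*-zeroʳ c)
sumFin-const (suc n) c = trans (cong (λ s → c + s) (sumFin-const n c)) (c+c*n≡c*[1+n] c (+ n))
  where
  c+c*n≡c*[1+n] : ∀ c n → c + c * n ≡ c * (+ 1 + n)
  c+c*n≡c*[1+n] = solve-∀

sumFin-zero : ∀ {n} {f : Fin n → ℤ} → (∀ i → f i ≡ + 0) → sumFin f ≡ + 0
sumFin-zero {n} f≗0 =
  trans (sumFin-cong f≗0) (trans (sumFin-const n (+ 0)) (ℤP.*-zeroˡ (+ n)))

sumFin-comm : ∀ {m n} (f : Fin m → Fin n → ℤ) →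
  sumFin (λ j → sumFin (λ i → f i j)) ≡ sumFin (λ i → sumFin (λ j → f i j))
sumFin-comm {zero} {n} f = sumFin-zero {n} (λ _ → refl)
sumFin-comm {suc m} f =
  trans (sumFin-+ (f zero) (λ j → sumFin (λ i → f (suc i) j)))
        (cong (λ s → sumFin (f zero) + s) (sumFin-comm (f ∘ suc)))

sumFin-↑ : ∀ p {q} (f : Fin (p ℕ.+ q) → ℤ) →
  sumFin f ≡ sumFin (λ i → f (i ↑ˡ q)) + sumFin (λ i → f (p ↑ʳ i))
sumFin-↑ zero    f = sym (ℤP.+-identityˡ _)
sumFin-↑ (suc p) f =
  trans (cong (λ s → f zero + s) (sumFin-↑ p (f ∘ suc))) (sym (ℤP.+-assoc (f zero) _ _))

i≡-i⇒i≡0 : ∀ {i} → i ≡ - i → i ≡ + 0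
i≡-i⇒i≡0 {+ zero}   _  = refl
i≡-i⇒i≡0 {+ suc n}  ()
i≡-i⇒i≡0 { -[1+ n ]} ()

s*[a*d]≡0 : ∀ s a {d} → d ≡ + 0 → s * (a * d) ≡ + 0
s*[a*d]≡0 s a refl = trans (cong (s *_) (ℤP.*-zeroʳ a)) (ℤP.*-zeroʳ s)

negOnePow-+ : ∀ m n → negOnePow (m ℕ.+ n) ≡ negOnePow m * negOnePow n
negOnePow-+ zero    n = sym (ℤP.*-identityˡ (negOnePow n))
negOnePow-+ (suc m) n = trans (cong -_ (negOnePow-+ m n)) (ℤP.neg-distribˡ-* (negOnePow m) (negOnePow n))

negOnePow-isEven : ∀ n → negOnePow n ≡ (if isEven n then + 1 else - + 1)
negOnePow-isEven zero    = refl
negOnePow-isEven (suc n) = trans (cong -_ (negOnePow-isEven n)) (flip (isEven n))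
  where
  flip : ∀ b → - (if b then + 1 else - + 1) ≡ (if not b then + 1 else - + 1)
  flip true  = refl
  flip false = refl

sumFrom-cong : ∀ {f g : ℕ → ℤ} l n → (∀ k → f k ≡ g k) → sumFrom f l n ≡ sumFrom g l n
sumFrom-cong l zero    f≗g = refl
sumFrom-cong l (suc n) f≗g = cong₂ _+_ (f≗g l) (sumFrom-cong (suc l) n f≗g)

sumFrom-suc : ∀ (f : ℕ → ℤ) l n → sumFrom f (suc l) n ≡ sumFrom (f ∘ suc) l n
sumFrom-suc f l zero    = refl
sumFrom-suc f l (suc n) = cong (λ s → f (suc l) + s) (sumFrom-suc f (suc l) n)

sumFrom-last : ∀ (f : ℕ → ℤ) l n → sumFrom f l (suc n) ≡ sumFrom f l n + f (l ℕ.+ n)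
sumFrom-last f l zero    = trans (ℤP.+-comm (f l) (+ 0)) (cong (λ k → + 0 + f k) (sym (ℕP.+-identityʳ l)))
sumFrom-last f l (suc n) = trans (cong (λ s → f l + s) (sumFrom-last f (suc l) n))
  (trans (sym (ℤP.+-assoc (f l) _ _)) (cong (λ k → f l + sumFrom f (suc l) n + f k) (sym (ℕP.+-suc l n))))

prodFrom-last : ∀ (a : ℕ → ℕ) l n → prodFrom a l (suc n) ≡ prodFrom a l n ℕ.* a (l ℕ.+ n)
prodFrom-last a l zero    = trans (ℕP.*-comm (a l) 1) (cong (λ k → 1 ℕ.* a k) (sym (ℕP.+-identityʳ l)))
prodFrom-last a l (suc n) = trans (cong (a l ℕ.*_) (prodFrom-last a (suc l) n))
  (trans (sym (ℕP.*-assoc (a l) _ _)) (cong (λ k → a l ℕ.* prodFrom a (suc l) n ℕ.* a k) (sym (ℕP.+-suc l n))))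

prodFromℤ : (ℕ → ℤ) → ℕ → ℕ → ℤ
prodFromℤ f l zero    = + 1
prodFromℤ f l (suc m) = f l * prodFromℤ f (suc l) m

^-distrib-* : ∀ u v n → (u * v) ^ n ≡ u ^ n * v ^ n
^-distrib-* u v zero    = refl
^-distrib-* u v (suc n) = trans (cong (u * v *_) (^-distrib-* u v n)) (interchange u v (u ^ n) (v ^ n))
  where
  interchange : ∀ u v p q → u * v * (p * q) ≡ u * p * (v * q)
  interchange = solve-∀

^-node : ∀ ρ f k w → (ρ * (f * ρ) ^ k) ^ w ≡ f ^ (w ℕ.* k) * ρ ^ (w ℕ.* suc k)
^-node ρ f k zero    = refl
^-node ρ f k (suc w) = begin
  ρ * (f * ρ) ^ k * (ρ * (f * ρ) ^ k) ^ w
    ≡⟨ cong₂ (λ u v → ρ * u * v) (^-distrib-* f ρ k) (^-node ρ f k w) ⟩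
  ρ * (f ^ k * ρ ^ k) * (f ^ (w ℕ.* k) * ρ ^ (w ℕ.* suc k))
    ≡⟨ regroup ρ (f ^ k) (ρ ^ k) (f ^ (w ℕ.* k)) (ρ ^ (w ℕ.* suc k)) ⟩
  f ^ k * f ^ (w ℕ.* k) * (ρ * ρ ^ k * ρ ^ (w ℕ.* suc k))
    ≡⟨ sym (cong₂ _*_ (ℤP.^-distribˡ-+-* f k (w ℕ.* k)) (ℤP.^-distribˡ-+-* ρ (suc k) (w ℕ.* suc k))) ⟩
  f ^ (suc w ℕ.* k) * ρ ^ (suc w ℕ.* suc k) ∎
  where
  open ≡-Reasoning
  regroup : ∀ ρ fk ρk fwk ρwk → ρ * (fk * ρk) * (fwk * ρwk) ≡ fk * fwk * (ρ * ρk * ρwk)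
  regroup = solve-∀

productℤ-++ : ∀ xs ys → productℤ (xs ++ ys) ≡ productℤ xs * productℤ ys
productℤ-++ []       ys = sym (ℤP.*-identityˡ (productℤ ys))
productℤ-++ (x ∷ xs) ys = trans (cong (x *_) (productℤ-++ xs ys)) (sym (ℤP.*-assoc x _ _))

productℤ-replicate : ∀ n v → productℤ (replicate n v) ≡ v ^ n
productℤ-replicate zero    v = refl
productℤ-replicate (suc n) v = cong (v *_) (productℤ-replicate n v)

productℤ-concat : ∀ xss → productℤ (concat xss) ≡ productℤ (map productℤ xss)
productℤ-concat []         = refl
productℤ-concat (xs ∷ xss) =
  trans (productℤ-++ xs (concat xss)) (cong (productℤ xs *_) (productℤ-concat xss))

productℤ-map-++ : ∀ (h : ℤ → ℤ) xs ys → productℤ (map h (xs ++ ys)) ≡ productℤ (map h xs) * productℤ (map h ys)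
productℤ-map-++ h xs ys = trans (cong productℤ (map-++ h xs ys)) (productℤ-++ (map h xs) (map h ys))

productℤ-map-replicate : ∀ (h : ℤ → ℤ) n v → productℤ (map h (replicate n v)) ≡ h v ^ n
productℤ-map-replicate h n v = trans (cong productℤ (map-replicate h n v)) (productℤ-replicate n (h v))

productℤ-map-concat : ∀ (h : ℤ → ℤ) xss → productℤ (map h (concat xss)) ≡ productℤ (map (productℤ ∘ map h) xss)
productℤ-map-concat h xss = begin
  productℤ (map h (concat xss))              ≡⟨ cong productℤ (sym (concat-map xss)) ⟩
  productℤ (concat (map (map h) xss))        ≡⟨ productℤ-concat (map (map h) xss) ⟩
  productℤ (map productℤ (map (map h) xss))  ≡⟨ cong productℤ (sym (map-∘ xss)) ⟩
  productℤ (map (productℤ ∘ map h) xss)      ∎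
  where open ≡-Reasoning

productℤ-applyUpTo : ∀ l n (f g : ℕ → ℤ) → (∀ k → f k ≡ g (l ℕ.+ k)) →
  productℤ (applyUpTo f n) ≡ prodFromℤ g l n
productℤ-applyUpTo l zero    f g f≗g = refl
productℤ-applyUpTo l (suc n) f g f≗g =
  cong₂ _*_ (trans (f≗g 0) (cong g (ℕP.+-identityʳ l)))
            (productℤ-applyUpTo (suc l) n (f ∘ suc) g λ k → trans (f≗g (suc k)) (cong g (ℕP.+-suc l k)))

prodFromℤ-last : ∀ (f : ℕ → ℤ) l n → prodFromℤ f l (suc n) ≡ prodFromℤ f l n * f (l ℕ.+ n)
prodFromℤ-last f l zero    = trans (ℤP.*-comm (f l) (+ 1)) (cong (λ k → + 1 * f k) (sym (ℕP.+-identityʳ l)))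
prodFromℤ-last f l (suc n) = trans (cong (f l *_) (prodFromℤ-last f (suc l) n))
  (trans (sym (ℤP.*-assoc (f l) _ _)) (cong (λ k → f l * prodFromℤ f (suc l) n * f k) (sym (ℕP.+-suc l n))))

sign : ∀ {n} → Fin n → ℤ
sign j = negOnePow (toℕ j)

det-cong : ∀ {n} {M N : Matrix n} → (∀ i j → M i j ≡ N i j) → det M ≡ det N
det-cong {zero}  M≗N = refl
det-cong {suc n} M≗N = sumFin-cong λ j →
  cong₂ (λ m d → sign j * (m * d)) (M≗N zero j) (det-cong (λ i k → M≗N (suc i) (punchIn j k)))

minor : ∀ {n} → Matrix (suc n) → Fin (suc n) → Matrix n
minor M j i k = M (suc i) (punchIn j k)

cofactor : ∀ {n} → (Fin n → Fin (suc n) → ℤ) → Fin (suc n) → ℤ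
cofactor R j = det (λ i k → R i (punchIn j k))

-- det M is definitionally expand (M zero) (M ∘ suc).
expand : ∀ {n} → (Fin (suc n) → ℤ) → (Fin n → Fin (suc n) → ℤ) → ℤ
expand v R = sumFin (λ j → sign j * (v j * cofactor R j))

-- Expansion along two rows v, w; the remaining rows are abstracted as a function F of
-- the surviving columns, which are named through e.
expand₂ : ∀ c {C : Set} (v w : Fin (suc (suc c)) → ℤ) (e : Fin (suc (suc c)) → C) →
  ((Fin c → C) → ℤ) → ℤ
expand₂ c v w e F =
  sumFin λ j → sign j * (v j * sumFin λ l → sign l * (w (punchIn j l) * F (e ∘ punchIn j ∘ punchIn l)))

expandTail : ∀ c {C : Set} (u : Fin (suc (suc c)) → ℤ) (e : Fin (suc (suc c)) → C) →
  ((Fin c → C) → ℤ) → ℤ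
expandTail c u e F = sumFin λ l → sign l * (u (suc l) * F (e ∘ suc ∘ punchIn l))

-- The part of expand₂ in which neither row uses column zero.
expandRest : ∀ c {C : Set} (v w : Fin (suc (suc c)) → ℤ) (e : Fin (suc (suc c)) → C) →
  ((Fin c → C) → ℤ) → ℤ
expandRest c v w e F =
  sumFin λ j → sign (suc j) * (v (suc j) * sumFin λ l →
    sign (suc l) * (w (suc (punchIn j l)) * F (e ∘ punchIn (suc j) ∘ punchIn (suc l))))

expand₂-split : ∀ c {C : Set} v w (e : Fin (suc (suc c)) → C) F →
  expand₂ c v w e F ≡ v zero * expandTail c w e F + (- w zero) * expandTail c v e F + expandRest c v w e F
expand₂-split c v w e F = begin
  + 1 * (v zero * expandTail c w e F) + sumFin (λ j → term j)
    ≡⟨ cong₂ _+_ (ℤP.*-identityˡ (v zero * expandTail c w e F))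
                 (sumFin-cong λ j → distrib (sign j) (v (suc j)) (w zero) (F (e ∘ suc ∘ punchIn j)) (restSum j)) ⟩
  v zero * expandTail c w e F + sumFin (λ j → - w zero * first j + inner j)
    ≡⟨ cong (λ s → v zero * expandTail c w e F + s) (sumFin-+ (λ j → - w zero * first j) inner) ⟩
  v zero * expandTail c w e F + (sumFin (λ j → - w zero * first j) + sumFin inner)
    ≡⟨ cong (λ s → v zero * expandTail c w e F + (s + sumFin inner)) (sumFin-*ˡ (- w zero) first) ⟩
  v zero * expandTail c w e F + (- w zero * expandTail c v e F + sumFin inner)
    ≡⟨ sym (ℤP.+-assoc (v zero * expandTail c w e F) _ _) ⟩
  v zero * expandTail c w e F + - w zero * expandTail c v e F + expandRest c v w e F ∎
  where
  open ≡-Reasoning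
  term first restSum inner : Fin (suc c) → ℤ
  term j = sign (suc j) * (v (suc j) * sumFin λ l →
    sign l * (w (punchIn (suc j) l) * F (e ∘ punchIn (suc j) ∘ punchIn l)))
  restSum j = sumFin λ l →
    sign (suc l) * (w (suc (punchIn j l)) * F (e ∘ punchIn (suc j) ∘ punchIn (suc l)))
  first j = sign j * (v (suc j) * F (e ∘ suc ∘ punchIn j))
  inner j = sign (suc j) * (v (suc j) * restSum j)
  distrib : ∀ s x w f r → - s * (x * (+ 1 * (w * f) + r)) ≡ - w * (s * (x * f)) + - s * (x * r)
  distrib = solve-∀

Congruent : ∀ {c} {C : Set} → ((Fin c → C) → ℤ) → Set
Congruent F = F Preserves _≗_ ⟶ _≡_

expandRest-zero : ∀ {C : Set} v w (e : Fin 2 → C) F → expandRest zero v w e F ≡ + 0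
expandRest-zero v w e F = sumFin-zero λ j → s*[a*d]≡0 (sign (suc j)) (v (suc j)) refl

expandRest-suc : ∀ c {C : Set} v w (e : Fin (suc (suc (suc c))) → C) F → Congruent F →
  expandRest (suc c) v w e F ≡ expand₂ c (v ∘ suc) (w ∘ suc) (e ∘ suc) (F ∘ (e zero Vector.∷_))
expandRest-suc c v w e F F-cong = sumFin-cong λ j → begin
  - sign j * (v (suc j) * sumFin (λ l → - sign l * (w (suc (punchIn j l)) * F (cols j l))))
    ≡⟨ cong (λ s → - sign j * (v (suc j) * s)) (trans
         (sumFin-cong λ l → trans (cong (λ f → - sign l * (w (suc (punchIn j l)) * f)) (F-cong (cols≗ j l)))
                                  (pull-sign (sign l) (w (suc (punchIn j l))) (F′ (cols′ j l))))
         (sumFin-*ˡ (- + 1) (λ l → sign l * (w (suc (punchIn j l)) * F′ (cols′ j l))))) ⟩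
  - sign j * (v (suc j) * (- + 1 * sumFin (λ l → sign l * (w (suc (punchIn j l)) * F′ (cols′ j l)))))
    ≡⟨ cancel-signs (sign j) (v (suc j)) _ ⟩
  sign j * (v (suc j) * sumFin (λ l → sign l * (w (suc (punchIn j l)) * F′ (cols′ j l)))) ∎
  where
  open ≡-Reasoning
  F′ : (Fin c → _) → ℤ
  F′ = F ∘ (e zero Vector.∷_)
  cols : Fin (suc (suc c)) → Fin (suc c) → Fin (suc c) → _
  cols j l = e ∘ punchIn (suc j) ∘ punchIn (suc l)
  cols′ : Fin (suc (suc c)) → Fin (suc c) → Fin c → _
  cols′ j l = e ∘ suc ∘ punchIn j ∘ punchIn l
  cols≗ : ∀ j l → cols j l ≗ (e zero Vector.∷ cols′ j l)
  cols≗ j l zero    = refl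
  cols≗ j l (suc k) = refl
  pull-sign : ∀ s w f → - s * (w * f) ≡ - + 1 * (s * (w * f))
  pull-sign = solve-∀
  cancel-signs : ∀ s x t → - s * (x * (- + 1 * t)) ≡ s * (x * t)
  cancel-signs = solve-∀

mutual
  expand₂-swap : ∀ c {C : Set} v w (e : Fin (suc (suc c)) → C) F → Congruent F →
    expand₂ c v w e F ≡ - expand₂ c w v e F
  expand₂-swap c v w e F F-cong = begin
    expand₂ c v w e F
      ≡⟨ expand₂-split c v w e F ⟩
    v zero * expandTail c w e F + - w zero * expandTail c v e F + expandRest c v w e F
      ≡⟨ cong (λ s → v zero * expandTail c w e F + - w zero * expandTail c v e F + s)
              (expandRest-swap c v w e F F-cong) ⟩
    v zero * expandTail c w e F + - w zero * expandTail c v e F + - expandRest c w v e F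
      ≡⟨ antisymmetric (v zero) (w zero) (expandTail c w e F) (expandTail c v e F) _ ⟩
    - (w zero * expandTail c v e F + - v zero * expandTail c w e F + expandRest c w v e F)
      ≡⟨ cong -_ (sym (expand₂-split c w v e F)) ⟩
    - expand₂ c w v e F ∎
    where
    open ≡-Reasoning
    antisymmetric : ∀ a b s t r → a * s + - b * t + - r ≡ - (b * t + - a * s + r)
    antisymmetric = solve-∀

  expandRest-swap : ∀ c {C : Set} v w (e : Fin (suc (suc c)) → C) F → Congruent F →
    expandRest c v w e F ≡ - expandRest c w v e F
  expandRest-swap zero v w e F F-cong =
    trans (expandRest-zero v w e F) (cong -_ (sym (expandRest-zero w v e F)))
  expandRest-swap (suc c) v w e F F-cong = begin
    expandRest (suc c) v w e F
      ≡⟨ expandRest-suc c v w e F F-cong ⟩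
    expand₂ c (v ∘ suc) (w ∘ suc) (e ∘ suc) (F ∘ (e zero Vector.∷_))
      ≡⟨ expand₂-swap c (v ∘ suc) (w ∘ suc) (e ∘ suc) _ (λ g≗h → F-cong (∷-cong g≗h)) ⟩
    - expand₂ c (w ∘ suc) (v ∘ suc) (e ∘ suc) (F ∘ (e zero Vector.∷_))
      ≡⟨ cong -_ (sym (expandRest-suc c w v e F F-cong)) ⟩
    - expandRest (suc c) w v e F ∎
    where
    open ≡-Reasoning
    ∷-cong : ∀ {g h : Fin c → _} → g ≗ h → (e zero Vector.∷ g) ≗ (e zero Vector.∷ h)
    ∷-cong g≗h zero    = refl
    ∷-cong g≗h (suc k) = g≗h k

rowsDet : ∀ {n} → (Fin (suc n) → Fin (suc (suc n)) → ℤ) → (Fin n → Fin (suc (suc n))) → ℤ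
rowsDet R g = det (λ i k → R (suc i) (g k))

rowsDet-congruent : ∀ {n} (R : Fin (suc n) → Fin (suc (suc n)) → ℤ) → Congruent (rowsDet R)
rowsDet-congruent R g≗h = det-cong (λ i k → cong (R (suc i)) (g≗h k))

expand₂-repeatedRow : ∀ c {C : Set} v (e : Fin (suc (suc c)) → C) F → Congruent F →
  expand₂ c v v e F ≡ + 0
expand₂-repeatedRow c v e F F-cong = i≡-i⇒i≡0 (expand₂-swap c v v e F F-cong)

expand-repeatedRow : ∀ {n} (R : Fin n → Fin (suc n) → ℤ) i → expand (R i) R ≡ + 0
expand-repeatedRow {suc n} R zero =
  expand₂-repeatedRow n (R zero) id (rowsDet R) (rowsDet-congruent R)
expand-repeatedRow {suc n} R (suc i) = begin
  expand₂ n (R (suc i)) (R zero) id (rowsDet R)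
    ≡⟨ expand₂-swap n (R (suc i)) (R zero) id (rowsDet R) (rowsDet-congruent R) ⟩
  - sumFin (λ j → sign j * (R zero j * expand (R (suc i) ∘ punchIn j) (λ i' k → R (suc i') (punchIn j k))))
    ≡⟨ cong -_ (sumFin-zero λ j →
         s*[a*d]≡0 (sign j) (R zero j) (expand-repeatedRow (λ i' k → R (suc i') (punchIn j k)) i)) ⟩
  + 0 ∎
  where open ≡-Reasoning

expand-cong : ∀ {n} {v w : Fin (suc n) → ℤ} {R R′ : Fin n → Fin (suc n) → ℤ} →
  (∀ k → v k ≡ w k) → (∀ i k → R i k ≡ R′ i k) → expand v R ≡ expand w R′
expand-cong v≗w R≗R′ = sumFin-cong λ j →
  cong₂ (λ a d → sign j * (a * d)) (v≗w j) (det-cong (λ i k → R≗R′ i (punchIn j k)))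

expand-linear : ∀ {n} (v w : Fin (suc n) → ℤ) d R →
  expand (λ k → v k + d * w k) R ≡ expand v R + d * expand w R
expand-linear v w d R = trans (sumFin-cong λ j → distrib (sign j) (v j) d (w j) (cofactor R j))
        (sumFin-linear (λ j → sign j * (v j * cofactor R j)) (λ j → sign j * (w j * cofactor R j)) d)
  where
  distrib : ∀ s a d b m → s * ((a + d * b) * m) ≡ s * (a * m) + d * (s * (b * m))
  distrib = solve-∀

expand-scale : ∀ {n} c (R : Fin n → Fin (suc n) → ℤ) → expand (λ _ → c) R ≡ c * expand (λ _ → + 1) R
expand-scale c R = trans (sumFin-cong λ j → pull (sign j) c (cofactor R j))
                         (sumFin-*ˡ c (λ j → sign j * (+ 1 * cofactor R j)))
  where
  pull : ∀ s c m → s * (c * m) ≡ c * (s * (+ 1 * m))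
  pull = solve-∀

expand-sumRows : ∀ {n} (R : Fin n → Fin (suc n) → ℤ) → expand (λ k → sumFin (λ i → R i k)) R ≡ + 0
expand-sumRows R = begin
  sumFin (λ j → sign j * (sumFin (λ i → R i j) * cofactor R j))
    ≡⟨ sumFin-cong (λ j → trans (cong (sign j *_) (sym (sumFin-*ʳ (cofactor R j) (λ i → R i j))))
                                 (sym (sumFin-*ˡ (sign j) (λ i → R i j * cofactor R j)))) ⟩
  sumFin (λ j → sumFin (λ i → sign j * (R i j * cofactor R j)))
    ≡⟨ sumFin-comm (λ i j → sign j * (R i j * cofactor R j)) ⟩
  sumFin (λ i → expand (R i) R)
    ≡⟨ sumFin-zero (expand-repeatedRow R) ⟩
  + 0 ∎
  where open ≡-Reasoning

expand₂-linearʳ : ∀ c {C : Set} v w₁ w₂ d (e : Fin (suc (suc c)) → C) F →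
  expand₂ c v (λ k → w₁ k + d * w₂ k) e F ≡ expand₂ c v w₁ e F + d * expand₂ c v w₂ e F
expand₂-linearʳ c v w₁ w₂ d e F = begin
  sumFin (λ j → sign j * (v j * sumFin λ l → sign l * ((w₁ (punchIn j l) + d * w₂ (punchIn j l)) * G j l)))
    ≡⟨ sumFin-cong (λ j → cong (λ s → sign j * (v j * s))
         (trans (sumFin-cong λ l → distribʳ (sign l) (w₁ (punchIn j l)) d (w₂ (punchIn j l)) (G j l))
                (sumFin-linear (λ l → sign l * (w₁ (punchIn j l) * G j l))
                               (λ l → sign l * (w₂ (punchIn j l) * G j l)) d))) ⟩
  sumFin (λ j → sign j * (v j * (I w₁ j + d * I w₂ j)))
    ≡⟨ sumFin-cong (λ j → distribˡ (sign j) (v j) (I w₁ j) d (I w₂ j)) ⟩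
  sumFin (λ j → sign j * (v j * I w₁ j) + d * (sign j * (v j * I w₂ j)))
    ≡⟨ sumFin-linear (λ j → sign j * (v j * I w₁ j)) (λ j → sign j * (v j * I w₂ j)) d ⟩
  expand₂ c v w₁ e F + d * expand₂ c v w₂ e F ∎
  where
  open ≡-Reasoning
  G : Fin (suc (suc c)) → Fin (suc c) → ℤ
  G j l = F (e ∘ punchIn j ∘ punchIn l)
  I : (Fin (suc (suc c)) → ℤ) → Fin (suc (suc c)) → ℤ
  I w j = sumFin (λ l → sign l * (w (punchIn j l) * G j l))
  distribʳ : ∀ s a d b g → s * ((a + d * b) * g) ≡ s * (a * g) + d * (s * (b * g))
  distribʳ = solve-∀
  distribˡ : ∀ s x a d b → s * (x * (a + d * b)) ≡ s * (x * a) + d * (s * (x * b))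
  distribˡ = solve-∀

expand-addMultiples : ∀ {n} (v : Fin (suc n) → ℤ) (R : Fin n → Fin (suc n) → ℤ) (c : Fin n → ℤ) →
  expand v (λ i k → R i k + c i * v k) ≡ expand v R
expand-addMultiples {zero}  v R c = refl
expand-addMultiples {suc n} v R c = begin
  expand₂ n v (λ k → R zero k + c zero * v k) id (rowsDet R′)
    ≡⟨ expand₂-linearʳ n v (R zero) v (c zero) id (rowsDet R′) ⟩
  expand₂ n v (R zero) id (rowsDet R′) + c zero * expand₂ n v v id (rowsDet R′)
    ≡⟨ cong (λ s → expand₂ n v (R zero) id (rowsDet R′) + c zero * s)
            (expand₂-repeatedRow n v id (rowsDet R′) (rowsDet-congruent R′)) ⟩
  expand₂ n v (R zero) id (rowsDet R′) + c zero * + 0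
    ≡⟨ trans (cong (λ s → expand₂ n v (R zero) id (rowsDet R′) + s) (ℤP.*-zeroʳ (c zero)))
             (ℤP.+-identityʳ _) ⟩
  expand₂ n v (R zero) id (rowsDet R′)
    ≡⟨ expand₂-swap n v (R zero) id (rowsDet R′) (rowsDet-congruent R′) ⟩
  - sumFin (λ j → sign j * (R zero j * expand (v ∘ punchIn j) (λ i k → R′ (suc i) (punchIn j k))))
    ≡⟨ cong -_ (sumFin-cong λ j → cong (λ s → sign j * (R zero j * s))
         (expand-addMultiples (v ∘ punchIn j) (λ i k → R (suc i) (punchIn j k)) (c ∘ suc))) ⟩
  - expand₂ n (R zero) v id (rowsDet R)
    ≡⟨ sym (expand₂-swap n v (R zero) id (rowsDet R) (rowsDet-congruent R)) ⟩
  expand v R ∎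
  where
  open ≡-Reasoning
  R′ : Fin (suc n) → Fin (suc (suc n)) → ℤ
  R′ i k = R i k + c i * v k

mutual
  det-zeroColumn : ∀ {n} (M : Matrix (suc n)) → (∀ i → M i zero ≡ + 0) → det M ≡ + 0
  det-zeroColumn M col₀ = sumFin-zero {f = λ j → sign j * (M zero j * cofactor (M ∘ suc) j)} λ where
    zero    → cong (λ a → + 1 * (a * cofactor (M ∘ suc) zero)) (col₀ zero)
    (suc j) → s*[a*d]≡0 (sign (suc j)) (M zero (suc j)) (cofactor-zeroColumn (M ∘ suc) (col₀ ∘ suc) j)

  cofactor-zeroColumn : ∀ {n} (R : Fin n → Fin (suc n) → ℤ) → (∀ i → R i zero ≡ + 0) →
    ∀ j → cofactor R (suc j) ≡ + 0
  cofactor-zeroColumn {suc n} R col₀ j = det-zeroColumn (λ i k → R i (punchIn (suc j) k)) col₀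

expand-ones-zeroColumn : ∀ {n} (R : Fin n → Fin (suc n) → ℤ) → (∀ i → R i zero ≡ + 0) →
  expand (λ _ → + 1) R ≡ det (λ i k → R i (suc k))
expand-ones-zeroColumn R col₀ =
  trans (cong₂ _+_ (trans (ℤP.*-identityˡ _) (ℤP.*-identityˡ (cofactor R zero)))
                   (sumFin-zero {f = λ j → sign (suc j) * (+ 1 * cofactor R (suc j))} λ j →
                      s*[a*d]≡0 (sign (suc j)) (+ 1) (cofactor-zeroColumn R col₀ j)))
        (ℤP.+-identityʳ (cofactor R zero))

colSum : ∀ {n} → Matrix n → Fin n → ℤ
colSum M j = sumFin (λ i → M i j)

-- The empty matrix is left unchanged (a junk case).
reduce : ∀ {n} → Matrix n → Matrix (ℕ.pred n)
reduce {zero}  M = M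
reduce {suc n} M i k = M (suc i) (suc k) - M (suc i) zero

reduce-shift : ∀ {n} (M : Matrix n) c → det (reduce (λ i j → M i j + c)) ≡ det (reduce M)
reduce-shift {zero}  M c = refl
reduce-shift {suc n} M c = det-cong (λ i j → shift-cancels (M (suc i) (suc j)) (M (suc i) zero) c)
  where
  shift-cancels : ∀ a b c → (a + c) - (b + c) ≡ a - b
  shift-cancels = solve-∀

-- Adding all rows to the first makes it constant α; subtracting that row, rescaled to
-- ones, from the others clears the first column.
det-constColSum : ∀ {n} (M : Matrix n) α → 0 < n → (∀ j → colSum M j ≡ α) → det M ≡ α * det (reduce M)
det-constColSum {suc n} M α _ colSum≡α = begin
  expand (M zero) R
    ≡⟨ sym (trans (cong (λ s → expand (M zero) R + + 1 * s) (expand-sumRows R)) (ℤP.+-identityʳ _)) ⟩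
  expand (M zero) R + + 1 * expand (λ k → sumFin (λ i → R i k)) R
    ≡⟨ sym (expand-linear (M zero) (λ k → sumFin (λ i → R i k)) (+ 1) R) ⟩
  expand (λ k → M zero k + + 1 * sumFin (λ i → R i k)) R
    ≡⟨ expand-cong {R = R} (λ k → trans (cong (λ s → M zero k + s) (ℤP.*-identityˡ _)) (colSum≡α k))
                           (λ _ _ → refl) ⟩
  expand (λ _ → α) R
    ≡⟨ expand-scale α R ⟩
  α * expand (λ _ → + 1) R
    ≡⟨ cong (α *_) (sym (expand-addMultiples (λ _ → + 1) R (λ i → - R i zero))) ⟩
  α * expand (λ _ → + 1) R′
    ≡⟨ cong (α *_) (trans (expand-ones-zeroColumn R′ R′-col₀) (det-cong R′≡reduce)) ⟩
  α * det (reduce M) ∎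
  where
  open ≡-Reasoning
  R R′ : Fin n → Fin (suc n) → ℤ
  R = M ∘ suc
  R′ i k = R i k + - R i zero * + 1
  a+[-b]*1≡a-b : ∀ a b → a + - b * + 1 ≡ a - b
  a+[-b]*1≡a-b = solve-∀
  R′≡reduce : ∀ i k → R′ i (suc k) ≡ reduce M i k
  R′≡reduce i k = a+[-b]*1≡a-b (R i (suc k)) (R i zero)
  R′-col₀ : ∀ i → R′ i zero ≡ + 0
  R′-col₀ i = trans (a+[-b]*1≡a-b (R i zero) (R i zero)) (ℤP.+-inverseʳ (R i zero))

toℕ-punchIn≤ : ∀ {n} (j : Fin (suc n)) k → toℕ (punchIn j k) ≤ suc (toℕ k)
toℕ-punchIn≤ zero    k       = ℕP.≤-refl
toℕ-punchIn≤ (suc j) zero    = z≤n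
toℕ-punchIn≤ (suc j) (suc k) = s≤s (toℕ-punchIn≤ j k)

toℕ-punchIn-< : ∀ {n} (j : Fin (suc n)) k → toℕ k < toℕ j → toℕ (punchIn j k) ≡ toℕ k
toℕ-punchIn-< (suc j) zero    _         = refl
toℕ-punchIn-< (suc j) (suc k) (s≤s k<j) = cong suc (toℕ-punchIn-< j k k<j)

punchIn-↑ˡ : ∀ {p} q (j : Fin (suc p)) k → punchIn (j ↑ˡ q) (k ↑ˡ q) ≡ punchIn j k ↑ˡ q
punchIn-↑ˡ q zero    k       = refl
punchIn-↑ˡ q (suc j) zero    = refl
punchIn-↑ˡ q (suc j) (suc k) = cong suc (punchIn-↑ˡ q j k)

punchIn-↑ʳ : ∀ p {q} (j : Fin (suc p)) (k : Fin q) → punchIn (j ↑ˡ q) (p ↑ʳ k) ≡ suc (p ↑ʳ k)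
punchIn-↑ʳ p       zero    k = refl
punchIn-↑ʳ (suc p) (suc j) k = cong suc (punchIn-↑ʳ p j k)

-- Rows s, s+1, … vanish on columns 0, …, s: more rows than available columns.
det-zeroBlock : ∀ {n} (M : Matrix n) s → s < n →
  (∀ i j → s ≤ toℕ i → toℕ j ≤ s → M i j ≡ + 0) → det M ≡ + 0
det-zeroBlock {suc n} M zero _ zeros = det-zeroColumn M (λ i → zeros i zero z≤n z≤n)
det-zeroBlock {suc (suc n)} M (suc s) (s≤s s<n) zeros = sumFin-zero λ j →
  s*[a*d]≡0 (sign j) (M zero j) (det-zeroBlock (minor M j) s s<n λ i k s≤i k≤s →
    zeros (suc i) (punchIn j k) (s≤s s≤i) (ℕP.≤-trans (toℕ-punchIn≤ j k) (s≤s k≤s)))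

det-blockByIndex : ∀ p q (M : Matrix (p ℕ.+ q)) → (∀ i j → p ≤ toℕ i → toℕ j < p → M i j ≡ + 0) →
  det M ≡ det (λ i j → M (i ↑ˡ q) (j ↑ˡ q)) * det (λ i j → M (p ↑ʳ i) (p ↑ʳ j))
det-blockByIndex zero    q M zeros = sym (ℤP.*-identityˡ (det M))
det-blockByIndex (suc p) q M zeros = begin
  det M
    ≡⟨ sumFin-↑ (suc p) (λ j → sign j * (M zero j * det (minor M j))) ⟩
  sumFin (λ j → sign (j ↑ˡ q) * (M zero (j ↑ˡ q) * det (minor M (j ↑ˡ q))))
    + sumFin (λ j → sign (suc p ↑ʳ j) * (M zero (suc p ↑ʳ j) * det (minor M (suc p ↑ʳ j))))
    ≡⟨ cong₂ _+_ (trans (sumFin-cong left) (sumFin-*ʳ (det D) (λ j → sign j * (A zero j * det (minor A j)))))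
                 (sumFin-zero right) ⟩
  det A * det D + + 0
    ≡⟨ ℤP.+-identityʳ _ ⟩
  det A * det D ∎
  where
  open ≡-Reasoning
  A : Matrix (suc p)
  A i j = M (i ↑ˡ q) (j ↑ˡ q)
  D : Matrix q
  D i j = M (suc p ↑ʳ i) (suc p ↑ʳ j)
  minor-block : ∀ j → det (minor M (j ↑ˡ q)) ≡ det (minor A j) * det D
  minor-block j = trans
    (det-blockByIndex p q (minor M (j ↑ˡ q)) λ i k p≤i k<p →
       zeros (suc i) (punchIn (j ↑ˡ q) k) (s≤s p≤i) (ℕP.≤-trans (s≤s (toℕ-punchIn≤ (j ↑ˡ q) k)) (s≤s k<p)))
    (cong₂ _*_ (det-cong (λ i k → cong (M (suc (i ↑ˡ q))) (punchIn-↑ˡ q j k)))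
               (det-cong (λ i k → cong (M (suc (p ↑ʳ i))) (punchIn-↑ʳ p j k))))
  minor-singular : ∀ j → det (minor M (suc p ↑ʳ j)) ≡ + 0
  minor-singular j = det-zeroBlock (minor M (suc p ↑ʳ j)) p p<p+q λ i k p≤i k≤p →
    zeros (suc i) (punchIn (suc p ↑ʳ j) k) (s≤s p≤i)
      (subst (_< suc p) (sym (toℕ-punchIn-< (suc p ↑ʳ j) k (k<j k k≤p))) (s≤s k≤p))
    where
    p<p+q : p < p ℕ.+ q
    p<p+q = ℕP.m<m+n p (ℕP.≤-trans (s≤s z≤n) (toℕ<n j))
    k<j : ∀ k → toℕ k ≤ p → toℕ k < toℕ (suc p ↑ʳ j)
    k<j k k≤p = subst (toℕ k <_) (sym (toℕ-↑ʳ (suc p) j)) (s≤s (ℕP.≤-trans k≤p (ℕP.m≤m+n p (toℕ j))))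
  reassoc : ∀ s a x d → s * (a * (x * d)) ≡ (s * (a * x)) * d
  reassoc = solve-∀
  left : ∀ j → sign (j ↑ˡ q) * (M zero (j ↑ˡ q) * det (minor M (j ↑ˡ q)))
             ≡ (sign j * (A zero j * det (minor A j))) * det D
  left j = trans (cong₂ (λ s d → s * (A zero j * d)) (cong negOnePow (toℕ-↑ˡ j q)) (minor-block j))
                 (reassoc (sign j) (A zero j) (det (minor A j)) (det D))
  right : ∀ j → sign (suc p ↑ʳ j) * (M zero (suc p ↑ʳ j) * det (minor M (suc p ↑ʳ j))) ≡ + 0
  right j = s*[a*d]≡0 (sign (suc p ↑ʳ j)) (M zero (suc p ↑ʳ j)) (minor-singular j)

↑-elim : ∀ {p q} {P : Fin (p ℕ.+ q) → Set} → (∀ i → P (i ↑ˡ q)) → (∀ i → P (p ↑ʳ i)) → ∀ i → P i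
↑-elim {p} {q} left right i with splitAt p i | join-splitAt p q i
... | inj₁ i′ | refl = left i′
... | inj₂ i′ | refl = right i′

det-blockTriangular : ∀ p q (M : Matrix (p ℕ.+ q)) → (∀ i j → M (p ↑ʳ i) (j ↑ˡ q) ≡ + 0) →
  det M ≡ det (λ i j → M (i ↑ˡ q) (j ↑ˡ q)) * det (λ i j → M (p ↑ʳ i) (p ↑ʳ j))
det-blockTriangular p q M zeros = det-blockByIndex p q M (↑-elim upper lower)
  where
  upper : ∀ i j → p ≤ toℕ (i ↑ˡ q) → toℕ j < p → M (i ↑ˡ q) j ≡ + 0
  upper i j p≤i _ = ⊥-elim (ℕP.<⇒≱ (subst (_< p) (sym (toℕ-↑ˡ i q)) (toℕ<n i)) p≤i)
  lower : ∀ i j → p ≤ toℕ (p ↑ʳ i) → toℕ j < p → M (p ↑ʳ i) j ≡ + 0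
  lower i = ↑-elim (λ j _ _ → zeros i j) λ j _ j<p →
    ⊥-elim (ℕP.<⇒≱ j<p (subst (p ≤_) (sym (toℕ-↑ʳ p j)) (ℕP.m≤m+n p (toℕ j))))

record IsBlock {p q} (M : Matrix (p ℕ.+ q)) (X : Matrix p) (c : ℤ) (Y : Matrix q) : Set where
  field
    upperLeft  : ∀ i j → M (i ↑ˡ q) (j ↑ˡ q) ≡ X i j
    lowerRight : ∀ i j → M (p ↑ʳ i) (p ↑ʳ j) ≡ Y i j
    upperRight : ∀ i j → M (i ↑ˡ q) (p ↑ʳ j) ≡ c
    lowerLeft  : ∀ i j → M (p ↑ʳ i) (j ↑ˡ q) ≡ c

module _ {p q} {M : Matrix (p ℕ.+ q)} {X : Matrix p} {c : ℤ} {Y : Matrix q} (block : IsBlock M X c Y) where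
  open IsBlock block

  isBlock-shift : ∀ d → IsBlock (λ i j → M i j + d) (λ i j → X i j + d) (c + d) (λ i j → Y i j + d)
  isBlock-shift d = record
    { upperLeft  = λ i j → cong (_+ d) (upperLeft i j)
    ; lowerRight = λ i j → cong (_+ d) (lowerRight i j)
    ; upperRight = λ i j → cong (_+ d) (upperRight i j)
    ; lowerLeft  = λ i j → cong (_+ d) (lowerLeft i j)
    }

  det-isBlock : c ≡ + 0 → det M ≡ det X * det Y
  det-isBlock c≡0 = trans (det-blockTriangular p q M (λ i j → trans (lowerLeft i j) c≡0))
                          (cong₂ _*_ (det-cong upperLeft) (det-cong lowerRight))

  colSum-isBlock-↑ˡ : ∀ j → colSum M (j ↑ˡ q) ≡ colSum X j + c * + q
  colSum-isBlock-↑ˡ j = trans (sumFin-↑ p (λ i → M i (j ↑ˡ q)))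
    (cong₂ _+_ (sumFin-cong (λ i → upperLeft i j)) (trans (sumFin-cong (λ i → lowerLeft i j)) (sumFin-const q c)))

  colSum-isBlock-↑ʳ : ∀ j → colSum M (p ↑ʳ j) ≡ c * + p + colSum Y j
  colSum-isBlock-↑ʳ j = trans (sumFin-↑ p (λ i → M i (p ↑ʳ j)))
    (cong₂ _+_ (trans (sumFin-cong (λ i → upperRight i j)) (sumFin-const p c)) (sumFin-cong (λ i → lowerRight i j)))


det-reduce-isBlock : ∀ {p q} {M : Matrix (p ℕ.+ q)} {X : Matrix p} {c : ℤ} {Y : Matrix q} →
  IsBlock M X c Y → 0 < p → det (reduce M) ≡ det (reduce X) * det (λ i j → Y i j - c)
det-reduce-isBlock {suc p} {q} {M} {X} {c} {Y} block _ =
  trans (det-blockTriangular p q (reduce M) lowerLeft₀)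
        (cong₂ _*_ (det-cong (λ i j → cong₂ _-_ (upperLeft (suc i) (suc j)) (upperLeft (suc i) zero)))
                   (det-cong (λ i j → cong₂ _-_ (lowerRight i j) (lowerLeft i zero))))
  where
  open IsBlock block
  lowerLeft₀ : ∀ i j → reduce M (p ↑ʳ i) (j ↑ˡ q) ≡ + 0
  lowerLeft₀ i j = trans (cong₂ _-_ (lowerLeft i (suc j)) (lowerLeft i zero)) (ℤP.+-inverseʳ c)

δ-↑ˡ : ∀ {p} q (i j : Fin p) → δ (i ↑ˡ q) (j ↑ˡ q) ≡ δ i j
δ-↑ˡ q zero    zero    = refl
δ-↑ˡ q zero    (suc j) = refl
δ-↑ˡ q (suc i) zero    = refl
δ-↑ˡ q (suc i) (suc j) = δ-↑ˡ q i j

δ-↑ʳ : ∀ p {q} (i j : Fin q) → δ (p ↑ʳ i) (p ↑ʳ j) ≡ δ i j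
δ-↑ʳ zero    i j = refl
δ-↑ʳ (suc p) i j = δ-↑ʳ p i j

δ-↑ˡ↑ʳ : ∀ {p} q (i : Fin p) (j : Fin q) → δ (i ↑ˡ q) (p ↑ʳ j) ≡ + 0
δ-↑ˡ↑ʳ q zero    j = refl
δ-↑ˡ↑ʳ q (suc i) j = δ-↑ˡ↑ʳ q i j

δ-↑ʳ↑ˡ : ∀ {p} q (i : Fin q) (j : Fin p) → δ (p ↑ʳ i) (j ↑ˡ q) ≡ + 0
δ-↑ʳ↑ˡ q i zero    = refl
δ-↑ʳ↑ˡ q i (suc j) = δ-↑ʳ↑ˡ q i j

module _ (l : Label) (t : Cotree) (ts : List Cotree) where
  adjs-↑ˡ : ∀ i j → adjs l (t ∷ ts) (i ↑ˡ sizes ts) (j ↑ˡ sizes ts) ≡ adj t i j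
  adjs-↑ˡ i j rewrite splitAt-↑ˡ (size t) i (sizes ts) | splitAt-↑ˡ (size t) j (sizes ts) = refl

  adjs-↑ʳ : ∀ i j → adjs l (t ∷ ts) (size t ↑ʳ i) (size t ↑ʳ j) ≡ adjs l ts i j
  adjs-↑ʳ i j rewrite splitAt-↑ʳ (size t) (sizes ts) i | splitAt-↑ʳ (size t) (sizes ts) j = refl

  adjs-↑ˡ↑ʳ : ∀ i j → adjs l (t ∷ ts) (i ↑ˡ sizes ts) (size t ↑ʳ j) ≡ cross l
  adjs-↑ˡ↑ʳ i j rewrite splitAt-↑ˡ (size t) i (sizes ts) | splitAt-↑ʳ (size t) (sizes ts) j = refl

  adjs-↑ʳ↑ˡ : ∀ i j → adjs l (t ∷ ts) (size t ↑ʳ i) (j ↑ˡ sizes ts) ≡ cross l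
  adjs-↑ʳ↑ˡ i j rewrite splitAt-↑ʳ (size t) (sizes ts) i | splitAt-↑ˡ (size t) j (sizes ts) = refl

sizes-replicate : ∀ n t → sizes (replicate n t) ≡ n ℕ.* size t
sizes-replicate zero    t = refl
sizes-replicate (suc n) t = cong (size t ℕ.+_) (sizes-replicate n t)

module _ (x : ℤ) where

  charMatrix : (t : Cotree) → Matrix (size t)
  charMatrix t i j = x * δ i j - adj t i j

  childrenMatrix : Label → (ts : List Cotree) → Matrix (sizes ts)
  childrenMatrix l ts i j = x * δ i j - adjs l ts i j

  childrenMatrix-isBlock : ∀ l t ts →
    IsBlock (childrenMatrix l (t ∷ ts)) (charMatrix t) (- cross l) (childrenMatrix l ts)
  childrenMatrix-isBlock l t ts = record
    { upperLeft  = λ i j → cong₂ (λ d a → x * d - a) (δ-↑ˡ (sizes ts) i j) (adjs-↑ˡ l t ts i j)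
    ; lowerRight = λ i j → cong₂ (λ d a → x * d - a) (δ-↑ʳ (size t) i j) (adjs-↑ʳ l t ts i j)
    ; upperRight = λ i j → trans (cong₂ (λ d a → x * d - a) (δ-↑ˡ↑ʳ (sizes ts) i j) (adjs-↑ˡ↑ʳ l t ts i j))
                                 (x*0-c≡-c x (cross l))
    ; lowerLeft  = λ i j → trans (cong₂ (λ d a → x * d - a) (δ-↑ʳ↑ˡ (sizes ts) i j) (adjs-↑ʳ↑ˡ l t ts i j))
                                 (x*0-c≡-c x (cross l))
    }
    where
    x*0-c≡-c : ∀ x c → x * + 0 - c ≡ - c
    x*0-c≡-c = solve-∀

  -- Constant column sums α of xI − A mean that the cograph is regular of degree x − α.
  record Regular (t : Cotree) (α ρ : ℤ) : Set where
    field
      nonempty   : 0 < size t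
      colSum≡    : ∀ j → colSum (charMatrix t) j ≡ α
      det-reduce : det (reduce (charMatrix t)) ≡ ρ

  charPoly-regular : ∀ {t α ρ} → Regular t α ρ → charPolyAt (adj t) x ≡ α * ρ
  charPoly-regular {t} {α} reg = trans (det-constColSum (charMatrix t) α nonempty colSum≡) (cong (α *_) det-reduce)
    where open Regular reg

  module _ (l : Label) {t α ρ} (reg : Regular t α ρ) where
    open Regular reg

    private
      c : ℤ
      c = cross l
      p : ℕ
      p = size t
      X : Matrix p
      X = charMatrix t

    det-shiftedChildren : ∀ k →
      det (λ i j → childrenMatrix l (replicate k t) i j + c) ≡ det (λ i j → X i j + c) ^ k
    det-shiftedChildren zero    = refl
    det-shiftedChildren (suc k) =
      trans (det-isBlock (isBlock-shift (childrenMatrix-isBlock l t (replicate k t)) c) (ℤP.+-inverseˡ c))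
            (cong (det (λ i j → X i j + c) *_) (det-shiftedChildren k))

    det-shifted : det (λ i j → X i j + c) ≡ (α + c * + p) * ρ
    det-shifted =
      trans (det-constColSum (λ i j → X i j + c) (α + c * + p) nonempty
               (λ j → trans (sumFin-+ (λ i → X i j) (λ _ → c)) (cong₂ _+_ (colSum≡ j) (sumFin-const p c))))
            (cong ((α + c * + p) *_) (trans (reduce-shift X c) det-reduce))

    colSum-children : ∀ k j → colSum (childrenMatrix l (replicate (suc k) t)) j ≡ α - c * + (k ℕ.* p)
    colSum-children k = ↑-elim first (rest k)
      where
      block : ∀ k → IsBlock (childrenMatrix l (replicate (suc k) t)) X (- c) (childrenMatrix l (replicate k t))
      block k = childrenMatrix-isBlock l t (replicate k t)
      first : ∀ j → colSum (childrenMatrix l (replicate (suc k) t)) (j ↑ˡ sizes (replicate k t)) ≡ α - c * + (k ℕ.* p)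
      first j = trans (colSum-isBlock-↑ˡ (block k) j)
        (trans (cong₂ (λ a s → a + - c * + s) (colSum≡ j) (sizes-replicate k t)) (a+[-c]*m≡a-c*m α c _))
        where
        a+[-c]*m≡a-c*m : ∀ a c m → a + - c * m ≡ a - c * m
        a+[-c]*m≡a-c*m = solve-∀
      rest : ∀ k j → colSum (childrenMatrix l (replicate (suc k) t)) (p ↑ʳ j) ≡ α - c * + (k ℕ.* p)
      rest (suc k) j = trans (colSum-isBlock-↑ʳ (block (suc k)) j)
        (trans (cong (λ s → - c * + p + s) (colSum-children k j))
               (trans (collect α c (+ p) (+ (k ℕ.* p))) (cong (λ m → α - c * m) (sym (ℤP.pos-+ p (k ℕ.* p))))))
        where
        collect : ∀ a c p m → - c * p + (a - c * m) ≡ a - c * (p + m)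
        collect = solve-∀

    det-reduceChildren : ∀ k →
      det (reduce (childrenMatrix l (replicate (suc k) t))) ≡ ρ * ((α + c * + p) * ρ) ^ k
    det-reduceChildren k = begin
      det (reduce (childrenMatrix l (replicate (suc k) t)))
        ≡⟨ det-reduce-isBlock (childrenMatrix-isBlock l t (replicate k t)) nonempty ⟩
      det (reduce X) * det (λ i j → childrenMatrix l (replicate k t) i j - - c)
        ≡⟨ cong₂ _*_ det-reduce
             (det-cong (λ i j → cong (λ d → childrenMatrix l (replicate k t) i j + d) (ℤP.neg-involutive c))) ⟩
      ρ * det (λ i j → childrenMatrix l (replicate k t) i j + c)
        ≡⟨ cong (ρ *_) (trans (det-shiftedChildren k) (cong (_^ k) det-shifted)) ⟩
      ρ * ((α + c * + p) * ρ) ^ k ∎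
      where open ≡-Reasoning

    node-regular : ∀ n → 1 ≤ n →
      Regular (node l (replicate n t)) (α - c * + ((n ∸ 1) ℕ.* p)) (ρ * ((α + c * + p) * ρ) ^ (n ∸ 1))
    node-regular (suc k) _ = record
      { nonempty   = ℕP.<-≤-trans nonempty (ℕP.m≤m+n p (sizes (replicate k t)))
      ; colSum≡    = colSum-children k
      ; det-reduce = det-reduceChildren k
      }

crossAt : ℕ → ℤ
crossAt ℓ = cross (levelLabel ℓ)

crossAt-suc : ∀ ℓ → crossAt ℓ ≡ crossAt (suc ℓ) + negOnePow ℓ
crossAt-suc ℓ = trans (alternate (isEven ℓ)) (cong (λ s → crossAt (suc ℓ) + s) (sym (negOnePow-isEven ℓ)))
  where
  alternate : ∀ b → cross (if b then join else union)
                  ≡ cross (if not b then join else union) + (if b then + 1 else - + 1)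
  alternate true  = refl
  alternate false = refl

ε-suc : ∀ ℓ → ε (suc ℓ) ≡ crossAt ℓ
ε-suc ℓ = lemma (isEven ℓ)
  where
  lemma : ∀ b → (if not b then + 0 else + 1) ≡ cross (if b then join else union)
  lemma true  = refl
  lemma false = refl

module Balanced (a : ℕ → ℕ) where

  segment : ℕ → ℕ → List ℕ
  segment ℓ zero    = []
  segment ℓ (suc m) = a (suc ℓ) ∷ segment (suc ℓ) m

  applyUpTo≡segment : ∀ ℓ m (f : ℕ → ℕ) → (∀ k → f k ≡ a (suc (ℓ ℕ.+ k))) → applyUpTo f m ≡ segment ℓ m
  applyUpTo≡segment ℓ zero    f f≗a = refl
  applyUpTo≡segment ℓ (suc m) f f≗a =
    cong₂ _∷_ (trans (f≗a 0) (cong (a ∘ suc) (ℕP.+-identityʳ ℓ)))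
              (applyUpTo≡segment (suc ℓ) m (f ∘ suc) λ k → trans (f≗a (suc k)) (cong (a ∘ suc) (ℕP.+-suc ℓ k)))

  size-balanced : ∀ ℓ m → size (balancedFrom ℓ (segment ℓ m)) ≡ prodFrom a (suc ℓ) m
  size-balanced ℓ zero    = refl
  size-balanced ℓ (suc m) =
    trans (sizes-replicate (a (suc ℓ)) _) (cong (a (suc ℓ) ℕ.*_) (size-balanced (suc ℓ) m))

  degree : ℕ → ℕ → ℤ
  degree ℓ zero    = + 0
  degree ℓ (suc m) = degree (suc ℓ) m + crossAt ℓ * + ((a (suc ℓ) ∸ 1) ℕ.* prodFrom a (suc (suc ℓ)) m)

  module _ (x : ℤ) where

    factor : ℕ → ℕ → ℤ
    factor ℓ m = x - degree (suc ℓ) m + crossAt ℓ * + prodFrom a (suc (suc ℓ)) m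

    reducedDet : ℕ → ℕ → ℤ
    reducedDet ℓ zero    = + 1
    reducedDet ℓ (suc m) = reducedDet (suc ℓ) m * (factor ℓ m * reducedDet (suc ℓ) m) ^ (a (suc ℓ) ∸ 1)

    leaf-regular : Regular x leaf (x - + 0) (+ 1)
    leaf-regular = record
      { nonempty   = s≤s z≤n
      ; colSum≡    = λ { zero → diagonal x }
      ; det-reduce = refl
      }
      where
      diagonal : ∀ x → x * + 1 - + 0 + + 0 ≡ x - + 0
      diagonal = solve-∀

    balanced-regular : ∀ ℓ m → (∀ i → ℓ < i → i ≤ ℓ ℕ.+ m → 1 ≤ a i) →
      Regular x (balancedFrom ℓ (segment ℓ m)) (x - degree ℓ m) (reducedDet ℓ m)
    balanced-regular ℓ zero    _   = leaf-regular
    balanced-regular ℓ (suc m) pos =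
      subst₂ (Regular x (balancedFrom ℓ (segment ℓ (suc m)))) α≡ ρ≡
        (node-regular x (levelLabel ℓ) child (a (suc ℓ)) (pos (suc ℓ) ℕP.≤-refl 1+ℓ≤ℓ+[1+m]))
      where
      1+ℓ≤ℓ+[1+m] : suc ℓ ≤ ℓ ℕ.+ suc m
      1+ℓ≤ℓ+[1+m] = subst (suc ℓ ≤_) (sym (ℕP.+-suc ℓ m)) (s≤s (ℕP.m≤m+n ℓ m))
      t : Cotree
      t = balancedFrom (suc ℓ) (segment (suc ℓ) m)
      α′ ρ : ℤ
      α′ = x - degree (suc ℓ) m
      ρ = reducedDet (suc ℓ) m
      child : Regular x t α′ ρ
      child = balanced-regular (suc ℓ) m λ i ℓ<i i≤ℓ+m →
        pos i (ℕP.<-trans (ℕP.n<1+n ℓ) ℓ<i) (subst (i ≤_) (sym (ℕP.+-suc ℓ m)) i≤ℓ+m)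
      α≡ : α′ - crossAt ℓ * + ((a (suc ℓ) ∸ 1) ℕ.* size t) ≡ x - degree ℓ (suc m)
      α≡ = trans (cong (λ s → α′ - crossAt ℓ * + ((a (suc ℓ) ∸ 1) ℕ.* s)) (size-balanced (suc ℓ) m))
                 (x-d-u≡x-[d+u] x (degree (suc ℓ) m) _)
        where
        x-d-u≡x-[d+u] : ∀ x d u → x - d - u ≡ x - (d + u)
        x-d-u≡x-[d+u] = solve-∀
      ρ≡ : ρ * ((α′ + crossAt ℓ * + size t) * ρ) ^ (a (suc ℓ) ∸ 1) ≡ reducedDet ℓ (suc m)
      ρ≡ = cong (λ s → ρ * ((α′ + crossAt ℓ * + s) * ρ) ^ (a (suc ℓ) ∸ 1)) (size-balanced (suc ℓ) m)

module ClosedForms (a : ℕ → ℕ) (r : ℕ) (pos : ∀ i → 1 ≤ i → i ≤ r → 1 ≤ a i) where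
  open Balanced a

  ≤-of-+≡ : ∀ {i m} → i ℕ.+ m ≡ r → i ≤ r
  ≤-of-+≡ {i} {m} eq = subst (i ≤_) eq (ℕP.m≤m+n i m)

  pred-a : ∀ i → 1 ≤ i → i ≤ r → + a i ≡ + 1 + + (a i ∸ 1)
  pred-a i 1≤i i≤r = trans (cong +_ (sym (ℕP.m+[n∸m]≡n (pos i 1≤i i≤r)))) (ℤP.pos-+ 1 (a i ∸ 1))

  r∸[1+ℓ]≡m : ∀ {ℓ m} → suc ℓ ℕ.+ m ≡ r → r ∸ suc ℓ ≡ m
  r∸[1+ℓ]≡m {ℓ} {m} eq = trans (cong (_∸ suc ℓ) (sym eq)) (ℕP.m+n∸m≡n (suc ℓ) m)

  altTerm : ℕ → ℤ
  altTerm j = γ a r j * negOnePow j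

  altSum : ℕ → ℕ → ℤ
  altSum i n = sumFrom (λ k → altTerm (i ℕ.+ k)) 1 n

  -- Both parity cases of x_r^i are the alternating sum Σ_k (-1)^(i+k) γ_{r,i+k}.
  xr≡altSum : ∀ i → xr a r i ≡ altSum i (r ∸ i) + ε r
  xr≡altSum i = parity (isEven i) (negOnePow-isEven i)
    where
    termwise : ∀ {σ} → negOnePow i ≡ σ → ∀ k → γ a r (i ℕ.+ k) * (σ * negOnePow k) ≡ altTerm (i ℕ.+ k)
    termwise σ≡ k = cong (γ a r (i ℕ.+ k) *_) (trans (cong (_* negOnePow k) (sym σ≡)) (sym (negOnePow-+ i k)))
    parity : ∀ b → negOnePow i ≡ (if b then + 1 else - + 1) →
      (if b then sumFrom (λ k → γ a r (i ℕ.+ k) * negOnePow k) 1 (r ∸ i) + ε r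
            else sumFrom (λ k → γ a r (i ℕ.+ k) * negOnePow (suc k)) 1 (r ∸ i) + ε r)
      ≡ altSum i (r ∸ i) + ε r
    parity true  σ≡ = cong (_+ ε r) (sumFrom-cong 1 (r ∸ i) λ k →
      trans (cong (γ a r (i ℕ.+ k) *_) (sym (ℤP.*-identityˡ (negOnePow k)))) (termwise σ≡ k))
    parity false σ≡ = cong (_+ ε r) (sumFrom-cong 1 (r ∸ i) λ k →
      trans (cong (γ a r (i ℕ.+ k) *_) (sym (ℤP.-1*i≡-i (negOnePow k)))) (termwise σ≡ k))

  altSum-suc : ∀ i n → altSum i (suc n) ≡ altTerm (suc i) + altSum (suc i) n
  altSum-suc i n = cong₂ _+_ (cong altTerm (ℕP.+-comm i 1))
    (trans (sumFrom-suc (λ k → altTerm (i ℕ.+ k)) 1 n) (sumFrom-cong 1 n λ k → cong altTerm (ℕP.+-suc i k)))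

  xr-closed : ∀ ℓ m → suc ℓ ℕ.+ m ≡ r →
    xr a r (suc ℓ) ≡ crossAt ℓ * + prodFrom a (suc (suc ℓ)) m - degree (suc ℓ) m
  xr-closed ℓ zero eq = begin
    xr a r (suc ℓ)                     ≡⟨ xr≡altSum (suc ℓ) ⟩
    altSum (suc ℓ) (r ∸ suc ℓ) + ε r  ≡⟨ cong₂ (λ n s → altSum (suc ℓ) n + ε s) (r∸[1+ℓ]≡m eq) r≡1+ℓ ⟩
    + 0 + ε (suc ℓ)                    ≡⟨ trans (ℤP.+-identityˡ _) (ε-suc ℓ) ⟩
    crossAt ℓ                          ≡⟨ c≡c*1-0 (crossAt ℓ) ⟩
    crossAt ℓ * + 1 - + 0              ∎
    where
    open ≡-Reasoning
    r≡1+ℓ : r ≡ suc ℓ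
    r≡1+ℓ = trans (sym eq) (cong suc (ℕP.+-identityʳ ℓ))
    c≡c*1-0 : ∀ c → c ≡ c * + 1 - + 0
    c≡c*1-0 = solve-∀
  xr-closed ℓ (suc m) eq = begin
    xr a r (suc ℓ)
      ≡⟨ trans (xr≡altSum (suc ℓ)) (cong (λ n → altSum (suc ℓ) n + ε r) (r∸[1+ℓ]≡m eq)) ⟩
    altSum (suc ℓ) (suc m) + ε r
      ≡⟨ trans (cong (_+ ε r) (altSum-suc (suc ℓ) m)) (ℤP.+-assoc (altTerm (suc (suc ℓ))) _ _) ⟩
    altTerm (suc (suc ℓ)) + (altSum (suc (suc ℓ)) m + ε r)
      ≡⟨ cong (λ s → altTerm (suc (suc ℓ)) + s)
           (sym (trans (xr≡altSum (suc (suc ℓ))) (cong (λ n → altSum (suc (suc ℓ)) n + ε r) (r∸[1+ℓ]≡m eq′)))) ⟩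
    altTerm (suc (suc ℓ)) + xr a r (suc (suc ℓ))
      ≡⟨ cong₂ _+_ (cong (λ n → + prodFrom a (suc (suc ℓ)) n * negOnePow (suc (suc ℓ))) (r∸[1+ℓ]≡m eq))
                   (xr-closed (suc ℓ) m eq′) ⟩
    + (A ℕ.* P) * - - σ + (c′ * + P - D)
      ≡⟨ cong₂ (λ u v → u * - - σ + (c′ * + P - v)) AP≡ (sym D≡) ⟩
    (+ 1 + K) * + P * - - σ + (c′ * + P - (degree (suc ℓ) (suc m) - c′ * (K * + P)))
      ≡⟨ regroup (+ P) K σ c′ (degree (suc ℓ) (suc m)) ⟩
    (c′ + σ) * ((+ 1 + K) * + P) - degree (suc ℓ) (suc m)
      ≡⟨ cong₂ (λ c u → c * u - degree (suc ℓ) (suc m)) (sym (crossAt-suc ℓ)) (sym AP≡) ⟩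
    crossAt ℓ * + prodFrom a (suc (suc ℓ)) (suc m) - degree (suc ℓ) (suc m) ∎
    where
    open ≡-Reasoning
    eq′ : suc (suc ℓ) ℕ.+ m ≡ r
    eq′ = trans (sym (ℕP.+-suc (suc ℓ) m)) eq
    A P : ℕ
    A = a (suc (suc ℓ))
    P = prodFrom a (suc (suc (suc ℓ))) m
    K σ c′ D : ℤ
    K = + (A ∸ 1)
    σ = negOnePow ℓ
    c′ = crossAt (suc ℓ)
    D = degree (suc (suc ℓ)) m
    AP≡ : + (A ℕ.* P) ≡ (+ 1 + K) * + P
    AP≡ = trans (ℤP.pos-* A P) (cong (_* + P) (pred-a (suc (suc ℓ)) (s≤s z≤n) (≤-of-+≡ eq′)))
    D≡ : degree (suc ℓ) (suc m) - c′ * (K * + P) ≡ D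
    D≡ = trans (cong (λ u → D + c′ * u - c′ * (K * + P)) (ℤP.pos-* (A ∸ 1) P)) (cancel D (c′ * (K * + P)))
      where
      cancel : ∀ d u → d + u - u ≡ d
      cancel = solve-∀
    regroup : ∀ p k σ c d → (+ 1 + k) * p * - - σ + (c * p - (d - c * (k * p))) ≡ (c + σ) * ((+ 1 + k) * p) - d
    regroup = solve-∀

  degree-sum : ∀ ℓ m → ℓ ℕ.+ m ≡ r →
    sumFrom (λ i → + mult a i * xr a r i) (suc ℓ) m ≡ + prodFrom a 1 ℓ * degree ℓ m
  degree-sum ℓ zero    eq = sym (ℤP.*-zeroʳ (+ prodFrom a 1 ℓ))
  degree-sum ℓ (suc m) eq = begin
    + mult a (suc ℓ) * xr a r (suc ℓ) + sumFrom (λ i → + mult a i * xr a r i) (suc (suc ℓ)) m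
      ≡⟨ cong₂ (λ u v → + mult a (suc ℓ) * u + v) (xr-closed ℓ m eq′) (degree-sum (suc ℓ) m eq′) ⟩
    + (W ℕ.* (A ∸ 1)) * (crossAt ℓ * + P - D) + + prodFrom a 1 (suc ℓ) * D
      ≡⟨ cong₂ (λ u v → u * (crossAt ℓ * + P - D) + v * D) (ℤP.pos-* W (A ∸ 1)) W′≡ ⟩
    + W * K * (crossAt ℓ * + P - D) + + W * (+ 1 + K) * D
      ≡⟨ collect (+ W) K (crossAt ℓ) (+ P) D ⟩
    + W * (D + crossAt ℓ * (K * + P))
      ≡⟨ cong (λ u → + W * (D + crossAt ℓ * u)) (sym (ℤP.pos-* (A ∸ 1) P)) ⟩
    + W * degree ℓ (suc m) ∎
    where
    open ≡-Reasoning
    eq′ : suc ℓ ℕ.+ m ≡ r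
    eq′ = trans (sym (ℕP.+-suc ℓ m)) eq
    W A P : ℕ
    W = prodFrom a 1 ℓ
    A = a (suc ℓ)
    P = prodFrom a (suc (suc ℓ)) m
    K D : ℤ
    K = + (A ∸ 1)
    D = degree (suc ℓ) m
    W′≡ : + prodFrom a 1 (suc ℓ) ≡ + W * (+ 1 + K)
    W′≡ = trans (cong +_ (prodFrom-last a 1 ℓ))
                (trans (ℤP.pos-* W A) (cong (+ W *_) (pred-a (suc ℓ) (s≤s z≤n) (≤-of-+≡ eq′))))
    collect : ∀ w k c p d → w * k * (c * p - d) + w * (+ 1 + k) * d ≡ w * (d + c * (k * p))
    collect = solve-∀

  xr[r]≡ε : xr a r r ≡ ε r
  xr[r]≡ε = trans (xr≡altSum r) (trans (cong (λ n → altSum r n + ε r) (ℕP.n∸n≡0 r)) (ℤP.+-identityˡ (ε r)))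

  -- x_r^r = ε_r, so the extra term of λ for odd r is the i = r term of the sum.
  lastEig≡degree : ∀ r′ → suc r′ ≡ r → lastEig a r ≡ degree 0 r
  lastEig≡degree r′ eq = begin
    lastEig a r
      ≡⟨ lastTerm (isEven r) (U (r ∸ 1)) (+ mult a r) ⟩
    U (r ∸ 1) + + mult a r * ε r
      ≡⟨ cong₂ (λ n e → U n + + mult a r * e) (cong (_∸ 1) (sym eq)) (sym xr[r]≡ε) ⟩
    U r′ + + mult a r * xr a r r
      ≡⟨ cong (λ i → U r′ + + mult a i * xr a r i) (sym eq) ⟩
    U r′ + + mult a (suc r′) * xr a r (suc r′)
      ≡⟨ sym (sumFrom-last (λ i → + mult a i * xr a r i) 1 r′) ⟩
    U (suc r′)
      ≡⟨ cong U eq ⟩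
    U r
      ≡⟨ trans (degree-sum 0 r refl) (ℤP.*-identityˡ _) ⟩
    degree 0 r ∎
    where
    open ≡-Reasoning
    U : ℕ → ℤ
    U = sumFrom (λ i → + mult a i * xr a r i) 1
    lastTerm : ∀ b u m → (if b then u else u + m) ≡ u + m * (if b then + 0 else + 1)
    lastTerm true  u m = sym (trans (cong (λ v → u + v) (ℤP.*-zeroʳ m)) (ℤP.+-identityʳ u))
    lastTerm false u m = cong (λ v → u + v) (sym (ℤP.*-identityʳ m))

  module _ (x : ℤ) where

    factor-closed : ∀ ℓ m → suc ℓ ℕ.+ m ≡ r → factor x ℓ m ≡ x - - xr a r (suc ℓ)
    factor-closed ℓ m eq = trans (rearrange x (degree (suc ℓ) m) (crossAt ℓ * + prodFrom a (suc (suc ℓ)) m))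
                                 (cong (λ u → x - - u) (sym (xr-closed ℓ m eq)))
      where
      rearrange : ∀ x d c → x - d + c ≡ x - - (c - d)
      rearrange = solve-∀

    reducedDet-closed : ∀ ℓ m → ℓ ℕ.+ m ≡ r →
      reducedDet x ℓ m ^ prodFrom a 1 ℓ ≡ prodFromℤ (λ i → (x - - xr a r i) ^ mult a i) (suc ℓ) m
    reducedDet-closed ℓ zero    eq = ℤP.^-zeroˡ (prodFrom a 1 ℓ)
    reducedDet-closed ℓ (suc m) eq = begin
      (ρ * (factor x ℓ m * ρ) ^ (A ∸ 1)) ^ W
        ≡⟨ ^-node ρ (factor x ℓ m) (A ∸ 1) W ⟩
      factor x ℓ m ^ mult a (suc ℓ) * ρ ^ (W ℕ.* suc (A ∸ 1))
        ≡⟨ cong₂ (λ f n → f ^ mult a (suc ℓ) * ρ ^ n) (factor-closed ℓ m eq′) W[1+[A∸1]]≡ ⟩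
      (x - - xr a r (suc ℓ)) ^ mult a (suc ℓ) * ρ ^ prodFrom a 1 (suc ℓ)
        ≡⟨ cong ((x - - xr a r (suc ℓ)) ^ mult a (suc ℓ) *_) (reducedDet-closed (suc ℓ) m eq′) ⟩
      prodFromℤ (λ i → (x - - xr a r i) ^ mult a i) (suc ℓ) (suc m) ∎
      where
      open ≡-Reasoning
      eq′ : suc ℓ ℕ.+ m ≡ r
      eq′ = trans (sym (ℕP.+-suc ℓ m)) eq
      W A : ℕ
      W = prodFrom a 1 ℓ
      A = a (suc ℓ)
      ρ : ℤ
      ρ = reducedDet x (suc ℓ) m
      W[1+[A∸1]]≡ : W ℕ.* suc (A ∸ 1) ≡ prodFrom a 1 (suc ℓ)
      W[1+[A∸1]]≡ = trans (cong (W ℕ.*_) (ℕP.m+[n∸m]≡n (pos (suc ℓ) (s≤s z≤n) (≤-of-+≡ eq′))))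
                          (sym (prodFrom-last a 1 ℓ))

    linearFactor : ℤ → ℤ
    linearFactor λ₀ = x - λ₀

    private
      H : ℕ → ℤ
      H i = (x - - xr a r i) ^ mult a i

    -- The eigenvalue 0 or -1 of multiplicity mult_r is -x_r^r, so all but λ are uniform.
    spectrum-product : ∀ r′ → suc r′ ≡ r →
      productℤ (map linearFactor (spectrumList a r)) ≡ prodFromℤ H 1 r′ * (H r * ((x - lastEig a r) * + 1))
    spectrum-product r′ eq = begin
      productℤ (map linearFactor (firstBlocks ++ lastBlock ++ [ lastEig a r ]))
        ≡⟨ trans (productℤ-map-++ linearFactor firstBlocks _)
                 (cong (productℤ (map linearFactor firstBlocks) *_) (productℤ-map-++ linearFactor lastBlock _)) ⟩
      productℤ (map linearFactor firstBlocks) * (productℤ (map linearFactor lastBlock) * ((x - lastEig a r) * + 1))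
        ≡⟨ cong₂ (λ u v → u * (v * ((x - lastEig a r) * + 1))) firstBlocks-product lastBlock-product ⟩
      prodFromℤ H 1 r′ * (H r * ((x - lastEig a r) * + 1)) ∎
      where
      open ≡-Reasoning
      block : ℕ → List ℤ
      block k = replicate (mult a (suc k)) (- xr a r (suc k))
      firstBlocks lastBlock : List ℤ
      firstBlocks = concat (applyUpTo block (r ∸ 1))
      lastBlock = replicate (mult a r) (if isEven r then + 0 else - + 1)
      firstBlocks-product : productℤ (map linearFactor firstBlocks) ≡ prodFromℤ H 1 r′
      firstBlocks-product = begin
        productℤ (map linearFactor (concat (applyUpTo block (r ∸ 1))))
          ≡⟨ productℤ-map-concat linearFactor (applyUpTo block (r ∸ 1)) ⟩
        productℤ (map (productℤ ∘ map linearFactor) (applyUpTo block (r ∸ 1)))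
          ≡⟨ cong productℤ (map-applyUpTo block (productℤ ∘ map linearFactor) (r ∸ 1)) ⟩
        productℤ (applyUpTo (productℤ ∘ map linearFactor ∘ block) (r ∸ 1))
          ≡⟨ cong (λ n → productℤ (applyUpTo (productℤ ∘ map linearFactor ∘ block) (n ∸ 1))) (sym eq) ⟩
        productℤ (applyUpTo (productℤ ∘ map linearFactor ∘ block) r′)
          ≡⟨ productℤ-applyUpTo 1 r′ _ H (λ k → productℤ-map-replicate linearFactor (mult a (suc k)) _) ⟩
        prodFromℤ H 1 r′ ∎
      -ε≡lastEntry : - ε r ≡ (if isEven r then + 0 else - + 1)
      -ε≡lastEntry = lemma (isEven r)
        where
        lemma : ∀ b → - (if b then + 0 else + 1) ≡ (if b then + 0 else - + 1)
        lemma true  = refl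
        lemma false = refl
      lastBlock-product : productℤ (map linearFactor lastBlock) ≡ H r
      lastBlock-product = trans (productℤ-map-replicate linearFactor (mult a r) _)
        (cong (λ e → (x - e) ^ mult a r) (sym (trans (cong -_ xr[r]≡ε) -ε≡lastEntry)))

    charPoly-closed : ∀ r′ → suc r′ ≡ r →
      (x - degree 0 r) * reducedDet x 0 r ≡ productℤ (map linearFactor (spectrumList a r))
    charPoly-closed r′ eq = begin
      (x - degree 0 r) * reducedDet x 0 r
        ≡⟨ cong₂ (λ d ρ → (x - d) * ρ) (sym (lastEig≡degree r′ eq))
                 (trans (sym (ℤP.^-identityʳ (reducedDet x 0 r))) (reducedDet-closed 0 r refl)) ⟩
      (x - lastEig a r) * prodFromℤ H 1 r
        ≡⟨ cong (λ n → (x - lastEig a r) * prodFromℤ H 1 n) (sym eq) ⟩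
      (x - lastEig a r) * prodFromℤ H 1 (suc r′)
        ≡⟨ cong ((x - lastEig a r) *_) (trans (prodFromℤ-last H 1 r′) (cong (λ i → prodFromℤ H 1 r′ * H i) eq)) ⟩
      (x - lastEig a r) * (prodFromℤ H 1 r′ * H r)
        ≡⟨ regroup (x - lastEig a r) (prodFromℤ H 1 r′) (H r) ⟩
      prodFromℤ H 1 r′ * (H r * ((x - lastEig a r) * + 1))
        ≡⟨ sym (spectrum-product r′ eq) ⟩
      productℤ (map linearFactor (spectrumList a r)) ∎
      where
      open ≡-Reasoning
      regroup : ∀ u p h → u * (p * h) ≡ p * (h * (u * + 1))
      regroup = solve-∀

corollary3 : (r : ℕ) → (a : ℕ → ℕ) → 2 ≤ r
    → (∀ i → 1 ≤ i → i ≤ r → 2 ≤ a i)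
    → (size (balancedCotree r a) ≡ prodFrom a 1 r)
      × IsSpectrum (adj (balancedCotree r a)) (spectrumList a r)
corollary3 r@(suc r′) a (s≤s _) a≥2 = size≡ , spectrum
  where
  open Balanced a
  pos : ∀ i → 1 ≤ i → i ≤ r → 1 ≤ a i
  pos i 1≤i i≤r = ℕP.≤-trans (s≤s z≤n) (a≥2 i 1≤i i≤r)
  open ClosedForms a r pos
  tree≡ : balancedCotree r a ≡ balancedFrom 0 (segment 0 r)
  tree≡ = cong (balancedFrom 0) (applyUpTo≡segment 0 r (a ∘ suc) (λ _ → refl))
  size≡ : size (balancedCotree r a) ≡ prodFrom a 1 r
  size≡ = trans (cong size tree≡) (size-balanced 0 r)
  spectrum : IsSpectrum (adj (balancedCotree r a)) (spectrumList a r)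
  spectrum x = begin
    charPolyAt (adj (balancedCotree r a)) x             ≡⟨ cong (λ t → charPolyAt (adj t) x) tree≡ ⟩
    charPolyAt (adj (balancedFrom 0 (segment 0 r))) x   ≡⟨ charPoly-regular x (balanced-regular x 0 r pos) ⟩
    (x - degree 0 r) * reducedDet x 0 r                  ≡⟨ charPoly-closed x r′ refl ⟩
    productℤ (map (λ l → x - l) (spectrumList a r))      ∎
    where open ≡-Reasoning
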